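{- In both $\mathsf{T}\mathbf{EFL}^{ - }$ and $\mathsf{T}\mathbf{EFL}$ the following rules are height-preserving admissible: weakening $(\mathsf{w}R)$: from $\Gamma\stackrel{\mathcal{T}}{\Rightarrow}\Delta$ infer $\Gamma\stackrel{\mathcal{T}}{\Rightarrow}\Delta,\alpha:@_n\varphi$; weakening $(\mathsf{w}L)$: from $\Gamma\stackrel{\mathcal{T}}{\Rightarrow}\Delta$ infer $\alpha:@_n\varphi,\Gamma\stackrel{\mathcal{T}}{\Rightarrow}\Delta$ (with $\alpha\in\mathcal{T}$); and substitution $(\mathsf{sub})$: from $\Gamma\stackrel{\mathcal{T}}{\Rightarrow}\Delta$ infer $\Gamma\sigma\stackrel{\mathcal{T}\sigma}{\Rightarrow}\Delta\sigma$, for any uniform substitution $\sigma$.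
   Context: Syntax. Disjoint countably infinite sets $\mathsf{Prop}$ and $\mathsf{Nom}$ (agent nominals). Formulas: $\varphi ::= n \mid p \mid \bot \mid \varphi\to\varphi \mid @_{n}\varphi \mid \mathsf{F}\varphi \mid \Box\varphi$; $\neg\varphi:=\varphi\to\bot$; $\langle\mathsf{F}\rangle\varphi:=\neg\mathsf{F}\neg\varphi$. $@$-prefixed formulas have the form $@_n\varphi$. $\varphi[m/k]$ replaces nominal $k$ by $m$ everywhere. A uniform substitution $\sigma$ maps propositional variables to formulas and nominals to nominals; $\varphi\sigma$ is the result of applying it. For a tree $\mathcal{T}$, $\mathcal{T}\sigma$ is the tree obtained by applying $\sigma$ to the nominals occurring in labels of $\mathcal{T}$ (so $\alpha\cdot_ni$ becomes $(\alpha\sigma)\cdot_{n\sigma}i$); for a set $\Theta$ of labelled formulas, $\Theta\sigma:=\{\alpha\sigma:\varphi\sigma : \alpha:\varphi\in\Theta\}$. Tree sequents. Labels: natural numbers, and $\alpha\cdot_ni$ (an $n$-child of $\alpha$). A tree: set of labels containing exactly one natural number (root), closed under parents. Labelled formula: $\alpha:\psi$, $\psi$ $@$-prefixed. Tree sequent $\Gamma\stackrel{\mathcal{T}}{\Rightarrow}\Delta$: finite sets of labelled formulas, finite tree containing their labels. Calculus $\mathsf{T}\mathbf{EFL}$ ($\alpha,\beta\in\mathcal{T}$; tree unchanged unless indicated). Initial: $\alpha:@_n\bot,\Gamma\Rightarrow\Delta$; $\alpha:@_n\varphi,\Gamma\Rightarrow\Delta,\alpha:@_n\varphi$. Rules (premises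 / conclusion): $(\mathsf{rep}_{=1})$ $\alpha:@_nm,\alpha:\varphi[n/k],\Gamma\Rightarrow\Delta$ / $\alpha:@_nm,\alpha:\varphi[m/k],\Gamma\Rightarrow\Delta$; $(\mathsf{rep}_{=2})$ $\alpha:@_nm,\alpha:\varphi[m/k],\Gamma\Rightarrow\Delta$ / $\alpha:@_nm,\alpha:\varphi[n/k],\Gamma\Rightarrow\Delta$; $(\mathsf{ref}_=)$ $\alpha:@_nn,\Gamma\Rightarrow\Delta$ / $\Gamma\Rightarrow\Delta$; $(\mathsf{rigid}_=)$ $\beta:@_nm,\Gamma\Rightarrow\Delta$ / $\alpha:@_nm,\Gamma\Rightarrow\Delta$; $(\to R)$ $\alpha:@_n\varphi,\Gamma\Rightarrow\Delta,\alpha:@_n\psi$ / $\Gamma\Rightarrow\Delta,\alpha:@_n(\varphi\to\psi)$; $(\to L)$ $\Gamma\Rightarrow\Delta,\alpha:@_n\varphi$ and $\alpha:@_n\psi,\Gamma\Rightarrow\Delta$ / $\alpha:@_n(\varphi\to\psi),\Gamma\Rightarrow\Delta$; $(@R)$ $\Gamma\Rightarrow\Delta,\alpha:@_m\varphi$ / $\Gamma\Rightarrow\Delta,\alpha:@_n@_m\varphi$; $(@L)$ $\alpha:@_m\varphi,\Gamma\Rightarrow\Delta$ / $\alpha:@_n@_m\varphi,\Gamma\Rightarrow\Delta$; $(\mathsf{F}R)$ $\alpha:@_n\langle\mathsf{F}\rangle m,\Gamma\Rightarrow\Delta,\alpha:@_m\varphi$ / $\Gamma\Rightarrow\Delta,\alpha:@_n\mathsf{F}\varphi$,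 $m$ not in the conclusion; $(\mathsf{F}L)$ $\Gamma\Rightarrow\Delta,\alpha:@_n\langle\mathsf{F}\rangle m$ and $\alpha:@_m\varphi,\Gamma\Rightarrow\Delta$ / $\alpha:@_n\mathsf{F}\varphi,\Gamma\Rightarrow\Delta$; $(\Box R)$ $\Gamma\stackrel{\mathcal{T}\cup\{\alpha\cdot_ni\}}{\Rightarrow}\Delta,\alpha\cdot_ni:@_n\varphi$ / $\Gamma\stackrel{\mathcal{T}}{\Rightarrow}\Delta,\alpha:@_n\Box\varphi$, $i$ fresh in the conclusion; $(\Box L)$ $\beta:@_n\varphi,\Gamma\Rightarrow\Delta$ / $\alpha:@_n\Box\varphi,\Gamma\Rightarrow\Delta$, $\beta$ an $n$-child of $\alpha$; $(w\mathsf{lab})$ $\Gamma\stackrel{\mathcal{T}}{\Rightarrow}\Delta$ / $\Gamma\stackrel{\mathcal{T}\cup\{\alpha\}}{\Rightarrow}\Delta$ if $\mathcal{T}\cup\{\alpha\}$ is a tree; $(Cut)$ $\Gamma\Rightarrow\Delta,\alpha:@_n\varphi$ and $\alpha:@_n\varphi,\Pi\Rightarrow\Sigma$ / $\Gamma,\Pi\Rightarrow\Delta,\Sigma$. $\mathsf{T}\mathbf{EFL}^{ - }$ is $\mathsf{T}\mathbf{EFL}$ without $(Cut)$. The height of a derivation is the maximum length of a branch from its root to an initial sequent. A rule is height-preserving admissible in a system if, whenever all its premises have derivations of height at most $h$, its conclusion has a derivation of height at most $h$. -}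

module Defs where

open import Data.Nat using (ℕ; zero; suc; _≡ᵇ_)
open import Data.Bool using (Bool; true; false; if_then_else_)
open import Data.List using (List; []; _∷_; _++_; map)
open import Data.List.Membership.Propositional using (_∈_)
open import Data.List.Relation.Unary.All using (All)
open import Data.Product using (Σ; _×_; _,_)
open import Data.Sum using (_⊎_)
open import Data.Empty using (⊥)
open import Relation.Binary.PropositionalEquality using (_≡_)
open import Relation.Nullary using (¬_)

-- Syntax.  Prop = ℕ (propositional variables), Nom = ℕ (agent nominals);
-- they are kept disjoint by the constructors `var` and `nom`.

infixr 6 _⟶_

data Fm : Set where
  nom  : ℕ → Fm
  var  : ℕ → Fm
  bot  : Fm
  _⟶_  : Fm → Fm → Fm
  at   : ℕ → Fm → Fm
  F    : Fm → Fm
  box  : Fm → Fm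

neg : Fm → Fm
neg φ = φ ⟶ bot

dF : Fm → Fm
dF φ = neg (F (neg φ))

record Subst : Set where
  field
    sP : ℕ → Fm
    sN : ℕ → ℕ
open Subst public

_[_]F : Fm → Subst → Fm
nom n   [ σ ]F = nom (sN σ n)
var p   [ σ ]F = sP σ p
bot     [ σ ]F = bot
(φ ⟶ ψ) [ σ ]F = (φ [ σ ]F) ⟶ (ψ [ σ ]F)
at n φ  [ σ ]F = at (sN σ n) (φ [ σ ]F)
F φ     [ σ ]F = F (φ [ σ ]F)
box φ   [ σ ]F = box (φ [ σ ]F)

rn : ℕ → ℕ → ℕ → ℕ
rn m k j = if j ≡ᵇ k then m else j

replS : ℕ → ℕ → Subst
replS m k = record { sP = var ; sN = rn m k }

repl : ℕ → ℕ → Fm → Fm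
repl m k φ = φ [ replS m k ]F

NomIn : ℕ → Fm → Set
NomIn m (nom n)  = m ≡ n
NomIn m (var p)  = ⊥
NomIn m bot      = ⊥
NomIn m (φ ⟶ ψ)  = NomIn m φ ⊎ NomIn m ψ
NomIn m (at n φ) = m ≡ n ⊎ NomIn m φ
NomIn m (F φ)    = NomIn m φ
NomIn m (box φ)  = NomIn m φ

data Label : Set where
  root  : ℕ → Label
  child : Label → ℕ → ℕ → Label     -- child α n i  =  α ·_n i

NumIn : ℕ → Label → Set
NumIn i (root j)      = i ≡ j
NumIn i (child α n j) = i ≡ j ⊎ NumIn i α

NomInL : ℕ → Label → Set
NomInL m (root j)      = ⊥
NomInL m (child α n j) = m ≡ n ⊎ NomInL m α

_[_]L : Label → Subst → Label
root r      [ σ ]L = root r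
child α n i [ σ ]L = child (α [ σ ]L) (sN σ n) i

-- Trees: finite sets of labels (represented by lists, considered up to
-- having the same elements), containing exactly one natural number
-- and closed under parents.

Tree : Set
Tree = List Label

IsTree : Tree → Set
IsTree T =
  (Σ ℕ λ r → (root r ∈ T) × (∀ r' → root r' ∈ T → r' ≡ r))
  × (∀ α n i → child α n i ∈ T → α ∈ T)

_[_]T : Tree → Subst → Tree
T [ σ ]T = map (λ α → α [ σ ]L) T

data LF : Set where
  lf : Label → ℕ → Fm → LF     -- lf α n φ  =  α : @_n φ

labelOf : LF → Label
labelOf (lf α n φ) = α

_[_]LF : LF → Subst → LF
lf α n φ [ σ ]LF = lf (α [ σ ]L) (sN σ n) (φ [ σ ]F)

NomInLF : ℕ → LF → Set
NomInLF m (lf α n φ) = NomInL m α ⊎ NomIn m (at n φ)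

-- finite sets of labelled formulas (lists up to same elements)
Ctx : Set
Ctx = List LF

_[_]C : Ctx → Subst → Ctx
Γ [ σ ]C = map (λ x → x [ σ ]LF) Γ

_≋_ : {A : Set} → List A → List A → Set
A ≋ B = (∀ x → x ∈ A → x ∈ B) × (∀ x → x ∈ B → x ∈ A)

IsTS : Tree → Ctx → Ctx → Set
IsTS T Γ Δ = IsTree T
           × All (λ x → labelOf x ∈ T) Γ
           × All (λ x → labelOf x ∈ T) Δ

FreshNom : ℕ → Tree → Ctx → Ctx → Set
FreshNom m T Γ Δ = (∀ x → x ∈ Γ → ¬ NomInLF m x)
                 × (∀ x → x ∈ Δ → ¬ NomInLF m x)
                 × (∀ α → α ∈ T → ¬ NomInL m α)

FreshNum : ℕ → Tree → Set
FreshNum i T = ∀ α → α ∈ T → ¬ NumIn i α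

-- The calculi.  `cut = true` : T EFL,  `cut = false` : T EFL⁻.
-- Der cut h T Γ Δ : the tree sequent Γ ⇒^T Δ has a derivation of
-- height at most h.  A derivation node is a tree sequent (considered up
-- to set equality of T, Γ, Δ) obtained by one rule instance (`Rule`).

mutual
  data Der (cut : Bool) : ℕ → Tree → Ctx → Ctx → Set where
    node : ∀ {h T Γ Δ T' Γ' Δ'} →
           IsTS T Γ Δ → T ≋ T' → Γ ≋ Γ' → Δ ≋ Δ' →
           Rule cut h T' Γ' Δ' → Der cut h T Γ Δ

  -- Rule cut h T Γ Δ : an instance of a rule with conclusion Γ ⇒^T Δ
  -- (sides written exactly), premises derivable with height ≤ h - 1.
  data Rule (cut : Bool) : ℕ → Tree → Ctx → Ctx → Set where
    init⊥ : ∀ {h T Γ Δ α n} →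
      Rule cut h T (lf α n bot ∷ Γ) Δ
    initAx : ∀ {h T Γ Δ α n φ} →
      Rule cut h T (lf α n φ ∷ Γ) (lf α n φ ∷ Δ)
    rep=1 : ∀ {h T Γ Δ α n m k j χ} →
      Der cut h T (lf α n (nom m) ∷ lf α (rn n k j) (repl n k χ) ∷ Γ) Δ →
      Rule cut (suc h) T (lf α n (nom m) ∷ lf α (rn m k j) (repl m k χ) ∷ Γ) Δ
    rep=2 : ∀ {h T Γ Δ α n m k j χ} →
      Der cut h T (lf α n (nom m) ∷ lf α (rn m k j) (repl m k χ) ∷ Γ) Δ →
      Rule cut (suc h) T (lf α n (nom m) ∷ lf α (rn n k j) (repl n k χ) ∷ Γ) Δ
    ref= : ∀ {h T Γ Δ α n} → α ∈ T →
      Der cut h T (lf α n (nom n) ∷ Γ) Δ →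
      Rule cut (suc h) T Γ Δ
    rigid= : ∀ {h T Γ Δ α β n m} → β ∈ T →
      Der cut h T (lf β n (nom m) ∷ Γ) Δ →
      Rule cut (suc h) T (lf α n (nom m) ∷ Γ) Δ
    →R : ∀ {h T Γ Δ α n φ ψ} →
      Der cut h T (lf α n φ ∷ Γ) (lf α n ψ ∷ Δ) →
      Rule cut (suc h) T Γ (lf α n (φ ⟶ ψ) ∷ Δ)
    →L : ∀ {h T Γ Δ α n φ ψ} →
      Der cut h T Γ (lf α n φ ∷ Δ) →
      Der cut h T (lf α n ψ ∷ Γ) Δ →
      Rule cut (suc h) T (lf α n (φ ⟶ ψ) ∷ Γ) Δ
    atR : ∀ {h T Γ Δ α n m φ} →
      Der cut h T Γ (lf α m φ ∷ Δ) →
      Rule cut (suc h) T Γ (lf α n (at m φ) ∷ Δ)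
    atL : ∀ {h T Γ Δ α n m φ} →
      Der cut h T (lf α m φ ∷ Γ) Δ →
      Rule cut (suc h) T (lf α n (at m φ) ∷ Γ) Δ
    FR : ∀ {h T Γ Δ α n m φ} →
      FreshNom m T Γ (lf α n (F φ) ∷ Δ) →
      Der cut h T (lf α n (dF (nom m)) ∷ Γ) (lf α m φ ∷ Δ) →
      Rule cut (suc h) T Γ (lf α n (F φ) ∷ Δ)
    FL : ∀ {h T Γ Δ α n m φ} →
      Der cut h T Γ (lf α n (dF (nom m)) ∷ Δ) →
      Der cut h T (lf α m φ ∷ Γ) Δ →
      Rule cut (suc h) T (lf α n (F φ) ∷ Γ) Δ
    □R : ∀ {h T Γ Δ α n i φ} →
      FreshNum i T →
      Der cut h (child α n i ∷ T) Γ (lf (child α n i) n φ ∷ Δ) →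
      Rule cut (suc h) T Γ (lf α n (box φ) ∷ Δ)
    □L : ∀ {h T Γ Δ α β n i φ} →
      β ≡ child α n i → β ∈ T →
      Der cut h T (lf β n φ ∷ Γ) Δ →
      Rule cut (suc h) T (lf α n (box φ) ∷ Γ) Δ
    wlab : ∀ {h T Γ Δ α} →
      Der cut h T Γ Δ →
      Rule cut (suc h) (α ∷ T) Γ Δ
    Cut : ∀ {h T Γ Δ Π Σ' α n φ} → cut ≡ true →
      Der cut h T Γ (lf α n φ ∷ Δ) →
      Der cut h T (lf α n φ ∷ Π) Σ' →
      Rule cut (suc h) T (Γ ++ Π) (Δ ++ Σ')

-- A derivation of Γ ⇒^T Δ can be pushed along a uniform substitution σ,
-- together with a renaming ρ of the numbers in labels, into any tree sequent
-- Γ' ⇒^T' Δ' containing its image, without increasing its height; weakening is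
-- the case where σ and ρ are identities.  Each rule instance is rebuilt with
-- Γ', Δ', T' appended to its side formulas, and set equality of sequents
-- absorbs the duplicates.  The eigen-nominal of (F R) and the eigen-number of
-- (□ R) need not stay fresh in the larger sequent, so they are renamed to fresh
-- ones by updating σ, resp. ρ, at them; this is harmless because they occur
-- nowhere else in the conclusion.  Likewise the replaced nominal k of (rep=) is
-- renamed to one fresh for the substituted formula, which makes replacement
-- commute with σ.
module Submission where

open import Defs
open import Data.Bool using (Bool; true; false; if_then_else_)
open import Data.Empty using (⊥-elim)
open import Data.List using (List; _∷_; _++_; map)
open import Data.List.Extrema.Nat using (max; xs≤max)
open import Data.List.Membership.Propositional using (_∈_)
open import Data.List.Membership.Propositional.Properties
  using (∈-map⁺; ∈-map⁻; ∈-++⁻)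
open import Data.List.Properties using (map-++; map-cong; map-cong-local; map-id)
open import Data.List.Relation.Binary.Subset.Propositional using (_⊆_)
open import Data.List.Relation.Binary.Subset.Propositional.Properties
  using (⊆-refl; ⊆-trans; ⊆-reflexive; map⁺; xs⊆x∷xs; ∷⁺ʳ; ∈-∷⁺ʳ; xs⊆xs++ys; xs⊆ys++xs)
open import Data.List.Relation.Unary.All as All using (All; _∷_)
import Data.List.Relation.Unary.All.Properties as All
open import Data.List.Relation.Unary.Any using (here; there)
open import Data.Nat using (ℕ; suc; _≡ᵇ_; _⊔_; _≤_)
open import Data.Nat.Properties
  using (≡ᵇ⇒≡; ≡⇒≡ᵇ; 1+n≰n; ≤-refl; ≤-trans; m≤m⊔n; m≤n⇒m≤n⊔o; m≤n⇒m≤o⊔n)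
open import Data.Product using (_×_; _,_; proj₁)
open import Data.Sum using (inj₁; inj₂; [_,_]′)
open import Function using (id; _∘_)
open import Relation.Binary.PropositionalEquality
  using (_≡_; _≢_; refl; sym; trans; cong; cong₂)
open import Relation.Nullary using (¬_)

≋-refl : {A : Set} {L : List A} → L ≋ L
≋-refl = (λ _ p → p) , (λ _ p → p)

⊆⇒≋ : {A : Set} {L M : List A} → L ⊆ M → M ⊆ L → L ≋ M
⊆⇒≋ L⊆M M⊆L = (λ _ → L⊆M) , (λ _ → M⊆L)

≋⇒⊇ : {A : Set} {L M : List A} → L ≋ M → M ⊆ L
≋⇒⊇ (_ , M⊆L) = M⊆L _

++-⊆ : {A : Set} {K L M : List A} → K ⊆ M → L ⊆ M → K ++ L ⊆ M
++-⊆ {K = K} K⊆M L⊆M p = [ K⊆M , L⊆M ]′ (∈-++⁻ K p)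

absorb : {A : Set} {K L : List A} → K ⊆ L → L ≋ (K ++ L)
absorb {K = K} K⊆L = ⊆⇒≋ (xs⊆ys++xs _ K) (++-⊆ K⊆L ⊆-refl)

absorb₂ : {A : Set} {K L M : List A} → K ++ L ⊆ M → M ≋ ((K ++ M) ++ (L ++ M))
absorb₂ {K = K} {L} KL⊆M =
  ⊆⇒≋ (⊆-trans (xs⊆ys++xs _ K) (xs⊆xs++ys _ _))
      (++-⊆ (++-⊆ (⊆-trans (xs⊆xs++ys K L) KL⊆M) ⊆-refl)
            (++-⊆ (⊆-trans (xs⊆ys++xs L K) KL⊆M) ⊆-refl))

map-cong-∈ : {A B : Set} {f g : A → B} {L : List A} →
             (∀ x → x ∈ L → f x ≡ g x) → map f L ≡ map g L
map-cong-∈ f≡g = map-cong-local (All.tabulate (f≡g _))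

IsTree-resp-≋ : ∀ {T T'} → T ≋ T' → IsTree T → IsTree T'
IsTree-resp-≋ (T⊆T' , T'⊆T) ((r , r∈ , unique) , closed) =
  (r , T⊆T' _ r∈ , λ r' p → unique r' (T'⊆T _ p)) ,
  (λ α n i p → T⊆T' α (closed α n i (T'⊆T _ p)))

IsTS-resp-≋ : ∀ {T Γ Δ T' Γ' Δ'} →
              T ≋ T' → Γ ≋ Γ' → Δ ≋ Δ' → IsTS T Γ Δ → IsTS T' Γ' Δ'
IsTS-resp-≋ eT eΓ eΔ (tr , gΓ , gΔ) =
  IsTree-resp-≋ eT tr ,
  All.tabulate (λ p → proj₁ eT _ (All.lookup gΓ (≋⇒⊇ eΓ p))) ,
  All.tabulate (λ p → proj₁ eT _ (All.lookup gΔ (≋⇒⊇ eΔ p)))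

IsTS-++ : ∀ {T₁ Γ₁ Δ₁ T Γ Δ} →
          T₁ ⊆ T → IsTS T₁ Γ₁ Δ₁ → IsTS T Γ Δ → IsTS T (Γ₁ ++ Γ) (Δ₁ ++ Δ)
IsTS-++ T₁⊆T (_ , gΓ₁ , gΔ₁) (tr , gΓ , gΔ) =
  tr , All.++⁺ (All.map T₁⊆T gΓ₁) gΓ , All.++⁺ (All.map T₁⊆T gΔ₁) gΔ

IsTree-child : ∀ {T α} n i → IsTree T → α ∈ T → IsTree (child α n i ∷ T)
IsTree-child {T} {α} n i ((r , r∈ , unique) , closed) α∈T = (r , there r∈ , unique′) , closed′
  where
  unique′ : ∀ r' → root r' ∈ child α n i ∷ T → r' ≡ r
  unique′ r' (here ())
  unique′ r' (there p) = unique r' p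
  closed′ : ∀ β m j → child β m j ∈ child α n i ∷ T → β ∈ child α n i ∷ T
  closed′ β m j (here refl) = there α∈T
  closed′ β m j (there p) = there (closed β m j p)

Der⇒IsTS : ∀ {c h T Γ Δ} → Der c h T Γ Δ → IsTS T Γ Δ
Der⇒IsTS (node ts _ _ _ _) = ts

Der-resp-≡ : ∀ {c h T Γ Δ T' Γ' Δ'} →
             T ≡ T' → Γ ≡ Γ' → Δ ≡ Δ' → Der c h T Γ Δ → Der c h T' Γ' Δ'
Der-resp-≡ refl refl refl d = d

-- Written with _≡ᵇ_, like rn, so that replS m k is definitionally idS [ k ↦ m ]ˢ.
_[_↦_] : (ℕ → ℕ) → ℕ → ℕ → ℕ → ℕ
(f [ k ↦ v ]) x = if x ≡ᵇ k then v else f x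

↦-here : ∀ f k v → (f [ k ↦ v ]) k ≡ v
↦-here f k v with k ≡ᵇ k | ≡⇒≡ᵇ k k refl
... | true  | _ = refl
... | false | ()

↦-there : ∀ f {k} v {x} → x ≢ k → (f [ k ↦ v ]) x ≡ f x
↦-there f {k} v {x} x≢k with x ≡ᵇ k | ≡ᵇ⇒≡ x k
... | false | _ = refl
... | true  | x≡k = ⊥-elim (x≢k (x≡k _))

_[_↦_]ˢ : Subst → ℕ → ℕ → Subst
σ [ k ↦ v ]ˢ = record { sP = sP σ ; sN = sN σ [ k ↦ v ] }

idS : Subst
idS = record { sP = var ; sN = id }

_[_∣_]L : Label → Subst → (ℕ → ℕ) → Label
root r      [ σ ∣ ρ ]L = root r
child α n i [ σ ∣ ρ ]L = child (α [ σ ∣ ρ ]L) (sN σ n) (ρ i)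

_[_∣_]LF : LF → Subst → (ℕ → ℕ) → LF
lf α n φ [ σ ∣ ρ ]LF = lf (α [ σ ∣ ρ ]L) (sN σ n) (φ [ σ ]F)

_[_∣_]C : Ctx → Subst → (ℕ → ℕ) → Ctx
Γ [ σ ∣ ρ ]C = map (λ x → x [ σ ∣ ρ ]LF) Γ

_[_∣_]T : Tree → Subst → (ℕ → ℕ) → Tree
T [ σ ∣ ρ ]T = map (λ α → α [ σ ∣ ρ ]L) T

lf-cong : ∀ {α α' n n' φ φ'} → α ≡ α' → n ≡ n' → φ ≡ φ' → lf α n φ ≡ lf α' n' φ'
lf-cong refl refl refl = refl

[]L-official : ∀ σ α → α [ σ ∣ id ]L ≡ α [ σ ]L
[]L-official σ (root r)      = refl
[]L-official σ (child α n i) = cong (λ β → child β (sN σ n) i) ([]L-official σ α)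

[]LF-official : ∀ σ x → x [ σ ∣ id ]LF ≡ x [ σ ]LF
[]LF-official σ (lf α n φ) = cong (λ β → lf β (sN σ n) (φ [ σ ]F)) ([]L-official σ α)

[]F-identity : ∀ φ → φ [ idS ]F ≡ φ
[]F-identity (nom n)  = refl
[]F-identity (var p)  = refl
[]F-identity bot      = refl
[]F-identity (φ ⟶ ψ)  = cong₂ _⟶_ ([]F-identity φ) ([]F-identity ψ)
[]F-identity (at n φ) = cong (at n) ([]F-identity φ)
[]F-identity (F φ)    = cong F ([]F-identity φ)
[]F-identity (box φ)  = cong box ([]F-identity φ)

[]L-identity : ∀ α → α [ idS ∣ id ]L ≡ α
[]L-identity (root r)      = refl
[]L-identity (child α n i) = cong (λ β → child β n i) ([]L-identity α)

[]LF-identity : ∀ x → x [ idS ∣ id ]LF ≡ x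
[]LF-identity (lf α n φ) = lf-cong ([]L-identity α) refl ([]F-identity φ)

[]C-identity : ∀ Γ → Γ [ idS ∣ id ]C ≡ Γ
[]C-identity Γ = trans (map-cong []LF-identity Γ) (map-id Γ)

[]T-identity : ∀ T → T [ idS ∣ id ]T ≡ T
[]T-identity T = trans (map-cong []L-identity T) (map-id T)

[]F-↦ˢ : ∀ {σ m v} φ → ¬ NomIn m φ → φ [ σ [ m ↦ v ]ˢ ]F ≡ φ [ σ ]F
[]F-↦ˢ {σ} {v = v} (nom n) m∉ = cong nom (↦-there (sN σ) v (m∉ ∘ sym))
[]F-↦ˢ (var p)  m∉ = refl
[]F-↦ˢ bot      m∉ = refl
[]F-↦ˢ (φ ⟶ ψ)  m∉ = cong₂ _⟶_ ([]F-↦ˢ φ (m∉ ∘ inj₁)) ([]F-↦ˢ ψ (m∉ ∘ inj₂))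
[]F-↦ˢ {σ} {v = v} (at n φ) m∉ =
  cong₂ at (↦-there (sN σ) v (m∉ ∘ inj₁ ∘ sym)) ([]F-↦ˢ φ (m∉ ∘ inj₂))
[]F-↦ˢ (F φ)    m∉ = cong F ([]F-↦ˢ φ m∉)
[]F-↦ˢ (box φ)  m∉ = cong box ([]F-↦ˢ φ m∉)

[]L-↦ˢ : ∀ {σ ρ m v} α → ¬ NomInL m α → α [ σ [ m ↦ v ]ˢ ∣ ρ ]L ≡ α [ σ ∣ ρ ]L
[]L-↦ˢ (root r) m∉ = refl
[]L-↦ˢ {σ} {ρ} {v = v} (child α n i) m∉ =
  cong₂ (λ β k → child β k (ρ i)) ([]L-↦ˢ α (m∉ ∘ inj₂)) (↦-there (sN σ) v (m∉ ∘ inj₁ ∘ sym))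

[]LF-↦ˢ : ∀ {σ ρ m v} x → ¬ NomInLF m x → x [ σ [ m ↦ v ]ˢ ∣ ρ ]LF ≡ x [ σ ∣ ρ ]LF
[]LF-↦ˢ {σ} {v = v} (lf α n φ) m∉ =
  lf-cong ([]L-↦ˢ α (m∉ ∘ inj₁)) (↦-there (sN σ) v (m∉ ∘ inj₂ ∘ inj₁ ∘ sym))
          ([]F-↦ˢ φ (m∉ ∘ inj₂ ∘ inj₂))

[]L-↦ : ∀ {σ ρ i v} α → ¬ NumIn i α → α [ σ ∣ ρ [ i ↦ v ] ]L ≡ α [ σ ∣ ρ ]L
[]L-↦ (root r) i∉ = refl
[]L-↦ {σ} {ρ} {v = v} (child α n j) i∉ =
  cong₂ (λ β → child β (sN σ n)) ([]L-↦ α (i∉ ∘ inj₂)) (↦-there ρ v (i∉ ∘ inj₁ ∘ sym))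

[]LF-↦ : ∀ {σ ρ i v} x → ¬ NumIn i (labelOf x) → x [ σ ∣ ρ [ i ↦ v ] ]LF ≡ x [ σ ∣ ρ ]LF
[]LF-↦ {σ} (lf α n φ) i∉ = cong (λ β → lf β (sN σ n) (φ [ σ ]F)) ([]L-↦ α i∉)

nomBoundF : Fm → ℕ
nomBoundF (nom n)  = n
nomBoundF (var p)  = 0
nomBoundF bot      = 0
nomBoundF (φ ⟶ ψ)  = nomBoundF φ ⊔ nomBoundF ψ
nomBoundF (at n φ) = n ⊔ nomBoundF φ
nomBoundF (F φ)    = nomBoundF φ
nomBoundF (box φ)  = nomBoundF φ

nomBoundL : Label → ℕ
nomBoundL (root r)      = 0
nomBoundL (child α n i) = n ⊔ nomBoundL α

nomBoundLF : LF → ℕ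
nomBoundLF (lf α n φ) = nomBoundL α ⊔ nomBoundF (at n φ)

numBound : Label → ℕ
numBound (root r)      = r
numBound (child α n i) = i ⊔ numBound α

≤-nomBoundF : ∀ {x} φ → NomIn x φ → x ≤ nomBoundF φ
≤-nomBoundF (nom n)  refl       = ≤-refl
≤-nomBoundF (φ ⟶ ψ)  (inj₁ p)   = m≤n⇒m≤n⊔o _ (≤-nomBoundF φ p)
≤-nomBoundF (φ ⟶ ψ)  (inj₂ p)   = m≤n⇒m≤o⊔n _ (≤-nomBoundF ψ p)
≤-nomBoundF (at n φ) (inj₁ refl) = m≤m⊔n n _
≤-nomBoundF (at n φ) (inj₂ p)   = m≤n⇒m≤o⊔n n (≤-nomBoundF φ p)
≤-nomBoundF (F φ)    p          = ≤-nomBoundF φ p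
≤-nomBoundF (box φ)  p          = ≤-nomBoundF φ p

≤-nomBoundL : ∀ {x} α → NomInL x α → x ≤ nomBoundL α
≤-nomBoundL (child α n i) (inj₁ refl) = m≤m⊔n n _
≤-nomBoundL (child α n i) (inj₂ p)    = m≤n⇒m≤o⊔n n (≤-nomBoundL α p)

≤-nomBoundLF : ∀ {x} y → NomInLF x y → x ≤ nomBoundLF y
≤-nomBoundLF (lf α n φ) (inj₁ p) = m≤n⇒m≤n⊔o _ (≤-nomBoundL α p)
≤-nomBoundLF (lf α n φ) (inj₂ p) = m≤n⇒m≤o⊔n (nomBoundL α) (≤-nomBoundF (at n φ) p)

≤-numBound : ∀ {i} α → NumIn i α → i ≤ numBound α
≤-numBound (root r)      refl        = ≤-refl
≤-numBound (child α n i) (inj₁ refl) = m≤m⊔n i _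
≤-numBound (child α n i) (inj₂ p)    = m≤n⇒m≤o⊔n i (≤-numBound α p)

maxOver : {A : Set} → (A → ℕ) → List A → ℕ
maxOver f L = max 0 (map f L)

≤-maxOver : {A : Set} (f : A → ℕ) {x : A} {L : List A} → x ∈ L → f x ≤ maxOver f L
≤-maxOver f {L = L} x∈L = All.lookup (xs≤max 0 (map f L)) (∈-map⁺ f x∈L)

suc-fresh : ∀ {P : ℕ → Set} b → (∀ {x} → P x → x ≤ b) → ¬ P (suc b)
suc-fresh b bound p = 1+n≰n (bound p)

freshNom : Tree → Ctx → Ctx → ℕ
freshNom T Γ Δ = suc (maxOver nomBoundL T ⊔ maxOver nomBoundLF Γ ⊔ maxOver nomBoundLF Δ)

freshNom-fresh : ∀ T Γ Δ → FreshNom (freshNom T Γ Δ) T Γ Δ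
freshNom-fresh T Γ Δ = fresh-in-Γ , fresh-in-Δ , fresh-in-T
  where
  a = maxOver nomBoundL T
  b = maxOver nomBoundLF Γ
  c = maxOver nomBoundLF Δ
  fresh-in-Γ : ∀ x → x ∈ Γ → ¬ NomInLF (freshNom T Γ Δ) x
  fresh-in-Γ x x∈ = suc-fresh _ λ p →
    m≤n⇒m≤n⊔o c (m≤n⇒m≤o⊔n a (≤-trans (≤-nomBoundLF x p) (≤-maxOver nomBoundLF x∈)))
  fresh-in-Δ : ∀ x → x ∈ Δ → ¬ NomInLF (freshNom T Γ Δ) x
  fresh-in-Δ x x∈ = suc-fresh _ λ p →
    m≤n⇒m≤o⊔n (a ⊔ b) (≤-trans (≤-nomBoundLF x p) (≤-maxOver nomBoundLF x∈))
  fresh-in-T : ∀ α → α ∈ T → ¬ NomInL (freshNom T Γ Δ) α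
  fresh-in-T α α∈ = suc-fresh _ λ p →
    m≤n⇒m≤n⊔o c (m≤n⇒m≤n⊔o b (≤-trans (≤-nomBoundL α p) (≤-maxOver nomBoundL α∈)))

freshNum : Tree → ℕ
freshNum T = suc (maxOver numBound T)

freshNum-fresh : ∀ T → FreshNum (freshNum T) T
freshNum-fresh T α α∈ = suc-fresh _ (λ p → ≤-trans (≤-numBound α p) (≤-maxOver numBound α∈))

repl-fresh : ∀ m {k} ψ → ¬ NomIn k ψ → repl m k ψ ≡ ψ
repl-fresh m ψ k∉ = trans ([]F-↦ˢ {idS} ψ k∉) ([]F-identity ψ)

rn-subst : ∀ σ m k {k'} x → sN σ x ≢ k' →
           sN σ (rn m k x) ≡ rn (sN σ m) k' (sN (σ [ k ↦ k' ]ˢ) x)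
rn-subst σ m k {k'} x σx≢k' with x ≡ᵇ k
... | true  = sym (↦-here id k' (sN σ m))
... | false = sym (↦-there id (sN σ m) σx≢k')

[]F-repl : ∀ σ m k {k'} ψ → ¬ NomIn k' (ψ [ σ ]F) →
           repl m k ψ [ σ ]F ≡ repl (sN σ m) k' (ψ [ σ [ k ↦ k' ]ˢ ]F)
[]F-repl σ m k (nom x)  k'∉ = cong nom (rn-subst σ m k x (k'∉ ∘ sym))
[]F-repl σ m k (var p)  k'∉ = sym (repl-fresh (sN σ m) (sP σ p) k'∉)
[]F-repl σ m k bot      k'∉ = refl
[]F-repl σ m k (φ ⟶ ψ)  k'∉ =
  cong₂ _⟶_ ([]F-repl σ m k φ (k'∉ ∘ inj₁)) ([]F-repl σ m k ψ (k'∉ ∘ inj₂))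
[]F-repl σ m k (at x φ) k'∉ =
  cong₂ at (rn-subst σ m k x (k'∉ ∘ inj₁ ∘ sym)) ([]F-repl σ m k φ (k'∉ ∘ inj₂))
[]F-repl σ m k (F φ)    k'∉ = cong F ([]F-repl σ m k φ k'∉)
[]F-repl σ m k (box φ)  k'∉ = cong box ([]F-repl σ m k φ k'∉)

replFresh : Subst → ℕ → Fm → ℕ
replFresh σ j χ = suc (nomBoundF (at j χ [ σ ]F))

[]LF-repl : ∀ σ ρ α x k j χ →
  let k' = replFresh σ j χ ; τ = σ [ k ↦ k' ]ˢ in
  lf α (rn x k j) (repl x k χ) [ σ ∣ ρ ]LF
    ≡ lf (α [ σ ∣ ρ ]L) (rn (sN σ x) k' (sN τ j)) (repl (sN σ x) k' (χ [ τ ]F))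
[]LF-repl σ ρ α x k j χ =
  lf-cong refl (rn-subst σ x k j (k'∉ ∘ inj₁ ∘ sym)) ([]F-repl σ x k χ (k'∉ ∘ inj₂))
  where
  k'∉ : ¬ NomIn (replFresh σ j χ) (at j χ [ σ ]F)
  k'∉ = suc-fresh _ (≤-nomBoundF (at j χ [ σ ]F))

IsTree-subst : ∀ σ ρ {T} → IsTree T → IsTree (T [ σ ∣ ρ ]T)
IsTree-subst σ ρ {T} ((r , r∈ , unique) , closed) = (r , ∈-map⁺ _ r∈ , unique′) , closed′
  where
  unique′ : ∀ r' → root r' ∈ T [ σ ∣ ρ ]T → r' ≡ r
  unique′ r' p with ∈-map⁻ _ p
  ... | root s , s∈ , refl = unique s s∈
  ... | child _ _ _ , _ , ()
  closed′ : ∀ α n i → child α n i ∈ T [ σ ∣ ρ ]T → α ∈ T [ σ ∣ ρ ]T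
  closed′ α n i p with ∈-map⁻ _ p
  ... | root _ , _ , ()
  ... | child β m j , β∈ , refl = ∈-map⁺ _ (closed β m j β∈)

labels-subst : ∀ σ ρ {T Γ} → All (λ x → labelOf x ∈ T) Γ →
               All (λ x → labelOf x ∈ T [ σ ∣ ρ ]T) (Γ [ σ ∣ ρ ]C)
labels-subst σ ρ {T} gΓ = All.map⁺ (All.map (λ {x} → label∈ {T} {x}) gΓ)
  where
  label∈ : ∀ {T x} → labelOf x ∈ T → labelOf (x [ σ ∣ ρ ]LF) ∈ T [ σ ∣ ρ ]T
  label∈ {x = lf α n φ} = ∈-map⁺ _

IsTS-subst : ∀ σ ρ {T Γ Δ} → IsTS T Γ Δ →
             IsTS (T [ σ ∣ ρ ]T) (Γ [ σ ∣ ρ ]C) (Δ [ σ ∣ ρ ]C)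
IsTS-subst σ ρ (tr , gΓ , gΔ) = IsTree-subst σ ρ tr , labels-subst σ ρ gΓ , labels-subst σ ρ gΔ

conclude : ∀ {c h T Γ Δ K L} → IsTS T Γ Δ → K ⊆ Γ → L ⊆ Δ →
           Rule c h T (K ++ Γ) (L ++ Δ) → Der c h T Γ Δ
conclude ts K⊆Γ L⊆Δ = node ts ≋-refl (absorb K⊆Γ) (absorb L⊆Δ)

mutual
  Der-subst-⊆ : ∀ {c h T Γ Δ T' Γ' Δ'} σ ρ → Der c h T Γ Δ →
                T [ σ ∣ ρ ]T ⊆ T' → Γ [ σ ∣ ρ ]C ⊆ Γ' → Δ [ σ ∣ ρ ]C ⊆ Δ' →
                IsTS T' Γ' Δ' → Der c h T' Γ' Δ'
  Der-subst-⊆ σ ρ (node ts eT eΓ eΔ r) T⊆ Γ⊆ Δ⊆ =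
    Rule-subst-⊆ σ ρ (IsTS-resp-≋ eT eΓ eΔ ts) r
      (⊆-trans (map⁺ _ (≋⇒⊇ eT)) T⊆)
      (⊆-trans (map⁺ _ (≋⇒⊇ eΓ)) Γ⊆)
      (⊆-trans (map⁺ _ (≋⇒⊇ eΔ)) Δ⊆)

  Der-subst-++ : ∀ {c h T Γ Δ T' Γ' Δ'} σ ρ → Der c h T Γ Δ →
                 T [ σ ∣ ρ ]T ⊆ T' → IsTS T' Γ' Δ' →
                 Der c h T' (Γ [ σ ∣ ρ ]C ++ Γ') (Δ [ σ ∣ ρ ]C ++ Δ')
  Der-subst-++ σ ρ d T⊆ ts' =
    Der-subst-⊆ σ ρ d T⊆ (xs⊆xs++ys _ _) (xs⊆xs++ys _ _)
      (IsTS-++ T⊆ (IsTS-subst σ ρ (Der⇒IsTS d)) ts')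

  Rule-subst-⊆ : ∀ {c h T Γ Δ T' Γ' Δ'} σ ρ → IsTS T Γ Δ → Rule c h T Γ Δ →
                 T [ σ ∣ ρ ]T ⊆ T' → Γ [ σ ∣ ρ ]C ⊆ Γ' → Δ [ σ ∣ ρ ]C ⊆ Δ' →
                 IsTS T' Γ' Δ' → Der c h T' Γ' Δ'
  Rule-subst-⊆ σ ρ _ init⊥     T⊆ Γ⊆ Δ⊆ ts' = conclude ts' Γ⊆ Δ⊆ init⊥
  Rule-subst-⊆ σ ρ _ initAx    T⊆ Γ⊆ Δ⊆ ts' = conclude ts' Γ⊆ Δ⊆ initAx
  Rule-subst-⊆ {Γ' = Γ'} σ ρ _ (rep=1 {Γ = Γ} {α = α} {n} {m} {k} {j} {χ} d) T⊆ Γ⊆ Δ⊆ ts' =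
    conclude ts' (⊆-trans (⊆-reflexive (cong ctx (sym ([]LF-repl σ ρ α m k j χ)))) Γ⊆) Δ⊆
      (rep=1 {k = k'} {j = sN τ j} {χ = χ [ τ ]F}
        (Der-resp-≡ refl (cong (λ b → ctx b ++ Γ') ([]LF-repl σ ρ α n k j χ)) refl
          (Der-subst-++ σ ρ d T⊆ ts')))
    where
    k' = replFresh σ j χ
    τ = σ [ k ↦ k' ]ˢ
    ctx : LF → Ctx
    ctx b = lf α n (nom m) [ σ ∣ ρ ]LF ∷ b ∷ Γ [ σ ∣ ρ ]C
  Rule-subst-⊆ {Γ' = Γ'} σ ρ _ (rep=2 {Γ = Γ} {α = α} {n} {m} {k} {j} {χ} d) T⊆ Γ⊆ Δ⊆ ts' =
    conclude ts' (⊆-trans (⊆-reflexive (cong ctx (sym ([]LF-repl σ ρ α n k j χ)))) Γ⊆) Δ⊆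
      (rep=2 {k = k'} {j = sN τ j} {χ = χ [ τ ]F}
        (Der-resp-≡ refl (cong (λ b → ctx b ++ Γ') ([]LF-repl σ ρ α m k j χ)) refl
          (Der-subst-++ σ ρ d T⊆ ts')))
    where
    k' = replFresh σ j χ
    τ = σ [ k ↦ k' ]ˢ
    ctx : LF → Ctx
    ctx b = lf α n (nom m) [ σ ∣ ρ ]LF ∷ b ∷ Γ [ σ ∣ ρ ]C
  Rule-subst-⊆ σ ρ _ (ref= α∈ d) T⊆ Γ⊆ Δ⊆ ts' =
    conclude ts' Γ⊆ Δ⊆ (ref= (T⊆ (∈-map⁺ _ α∈)) (Der-subst-++ σ ρ d T⊆ ts'))
  Rule-subst-⊆ σ ρ _ (rigid= β∈ d) T⊆ Γ⊆ Δ⊆ ts' =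
    conclude ts' Γ⊆ Δ⊆ (rigid= (T⊆ (∈-map⁺ _ β∈)) (Der-subst-++ σ ρ d T⊆ ts'))
  Rule-subst-⊆ σ ρ _ (→R d) T⊆ Γ⊆ Δ⊆ ts' =
    conclude ts' Γ⊆ Δ⊆ (→R (Der-subst-++ σ ρ d T⊆ ts'))
  Rule-subst-⊆ σ ρ _ (→L d e) T⊆ Γ⊆ Δ⊆ ts' =
    conclude ts' Γ⊆ Δ⊆ (→L (Der-subst-++ σ ρ d T⊆ ts') (Der-subst-++ σ ρ e T⊆ ts'))
  Rule-subst-⊆ σ ρ _ (atR d) T⊆ Γ⊆ Δ⊆ ts' =
    conclude ts' Γ⊆ Δ⊆ (atR (Der-subst-++ σ ρ d T⊆ ts'))
  Rule-subst-⊆ σ ρ _ (atL d) T⊆ Γ⊆ Δ⊆ ts' =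
    conclude ts' Γ⊆ Δ⊆ (atL (Der-subst-++ σ ρ d T⊆ ts'))
  Rule-subst-⊆ {T' = T'} {Γ'} {Δ'} σ ρ _
      (FR {T = T} {Γ} {Δ} {α} {n} {m} {φ} (Γ-fresh , Δ-fresh , T-fresh) d) T⊆ Γ⊆ Δ⊆ ts' =
    conclude ts' Γ⊆ Δ⊆
      (FR {m = m'} (freshNom-fresh T' _ _) (Der-resp-≡ refl eΓ eΔ (Der-subst-++ σ' ρ d T⊆' ts')))
    where
    m' = freshNom T' ((Γ [ σ ∣ ρ ]C) ++ Γ') ((lf α n (F φ) ∷ Δ) [ σ ∣ ρ ]C ++ Δ')
    σ' = σ [ m ↦ m' ]ˢ
    m∉Fφ : ¬ NomInLF m (lf α n (F φ))
    m∉Fφ = Δ-fresh _ (here refl)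
    eα : α [ σ' ∣ ρ ]L ≡ α [ σ ∣ ρ ]L
    eα = []L-↦ˢ α (m∉Fφ ∘ inj₁)
    en : sN σ' n ≡ sN σ n
    en = ↦-there (sN σ) m' (m∉Fφ ∘ inj₂ ∘ inj₁ ∘ sym)
    em : sN σ' m ≡ m'
    em = ↦-here (sN σ) m m'
    T⊆' : T [ σ' ∣ ρ ]T ⊆ T'
    T⊆' = ⊆-trans (⊆-reflexive (map-cong-∈ (λ β β∈ → []L-↦ˢ β (T-fresh β β∈)))) T⊆
    eΓ = cong₂ _∷_ (lf-cong eα en (cong (dF ∘ nom) em))
                   (cong (_++ Γ') (map-cong-∈ (λ x x∈ → []LF-↦ˢ x (Γ-fresh x x∈))))
    eΔ = cong₂ _∷_ (lf-cong eα em ([]F-↦ˢ φ (m∉Fφ ∘ inj₂ ∘ inj₂)))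
                   (cong (_++ Δ') (map-cong-∈ (λ x x∈ → []LF-↦ˢ x (Δ-fresh x (there x∈)))))
  Rule-subst-⊆ σ ρ _ (FL d e) T⊆ Γ⊆ Δ⊆ ts' =
    conclude ts' Γ⊆ Δ⊆ (FL (Der-subst-++ σ ρ d T⊆ ts') (Der-subst-++ σ ρ e T⊆ ts'))
  Rule-subst-⊆ {T' = T'} {Γ'} {Δ'} σ ρ (_ , gΓ , gΔ)
      (□R {T = T} {Γ} {Δ} {α} {n} {i} {φ} i-fresh d) T⊆ Γ⊆ Δ⊆ ts'@(tr' , gΓ' , gΔ') =
    conclude ts' Γ⊆ Δ⊆
      (□R (freshNum-fresh T') (Der-resp-≡ refl eΓ eΔ (Der-subst-++ σ ρ' d T⊆' ts″)))
    where
    i' = freshNum T'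
    ρ' = ρ [ i ↦ i' ]
    β' = child (α [ σ ∣ ρ ]L) (sN σ n) i'
    unmoved : ∀ β → β ∈ T → β [ σ ∣ ρ' ]L ≡ β [ σ ∣ ρ ]L
    unmoved β β∈ = []L-↦ β (i-fresh β β∈)
    eβ : child α n i [ σ ∣ ρ' ]L ≡ β'
    eβ = cong₂ (λ γ → child γ (sN σ n)) (unmoved α (All.lookup gΔ (here refl))) (↦-here ρ i i')
    T⊆' : (child α n i ∷ T) [ σ ∣ ρ' ]T ⊆ β' ∷ T'
    T⊆' = ⊆-trans (⊆-reflexive (cong₂ _∷_ eβ (map-cong-∈ unmoved))) (∷⁺ʳ β' T⊆)
    ts″ : IsTS (β' ∷ T') Γ' Δ'
    ts″ = IsTree-child (sN σ n) i' tr' (All.lookup gΔ' (Δ⊆ (here refl))) ,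
          All.map there gΓ' , All.map there gΔ'
    unmovedLF : ∀ {Θ} → All (λ x → labelOf x ∈ T) Θ → Θ [ σ ∣ ρ' ]C ≡ Θ [ σ ∣ ρ ]C
    unmovedLF gΘ = map-cong-∈ (λ x x∈ → []LF-↦ x (i-fresh _ (All.lookup gΘ x∈)))
    eΓ = cong (_++ Γ') (unmovedLF gΓ)
    eΔ = cong₂ _∷_ (cong (λ γ → lf γ (sN σ n) (φ [ σ ]F)) eβ)
                   (cong (_++ Δ') (unmovedLF (All.tail gΔ)))
  Rule-subst-⊆ σ ρ _ (□L β≡ β∈ d) T⊆ Γ⊆ Δ⊆ ts' =
    conclude ts' Γ⊆ Δ⊆
      (□L (cong (_[ σ ∣ ρ ]L) β≡) (T⊆ (∈-map⁺ _ β∈)) (Der-subst-++ σ ρ d T⊆ ts'))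
  Rule-subst-⊆ σ ρ _ (wlab d) T⊆ Γ⊆ Δ⊆ ts' =
    node ts' (absorb (∈-∷⁺ʳ (T⊆ (here refl)) (λ ()))) (absorb Γ⊆) (absorb Δ⊆)
      (wlab (Der-subst-++ σ ρ d (⊆-trans (xs⊆x∷xs _ _) T⊆) ts'))
  Rule-subst-⊆ σ ρ _ (Cut {Γ = Γ} {Δ} {Π} {Σ'} c≡true d e) T⊆ Γ⊆ Δ⊆ ts' =
    node ts' ≋-refl (absorb₂ {K = Γ [ σ ∣ ρ ]C} (split Γ Π Γ⊆))
                    (absorb₂ {K = Δ [ σ ∣ ρ ]C} (split Δ Σ' Δ⊆))
      (Cut c≡true (Der-subst-++ σ ρ d T⊆ ts') (Der-subst-++ σ ρ e T⊆ ts'))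
    where
    split : ∀ {M} K L → (K ++ L) [ σ ∣ ρ ]C ⊆ M → K [ σ ∣ ρ ]C ++ L [ σ ∣ ρ ]C ⊆ M
    split K L KL⊆M = ⊆-trans (⊆-reflexive (sym (map-++ (_[ σ ∣ ρ ]LF) K L))) KL⊆M

Der-mono : ∀ {c h T Γ Δ T' Γ' Δ'} → Der c h T Γ Δ →
           T ⊆ T' → Γ ⊆ Γ' → Δ ⊆ Δ' → IsTS T' Γ' Δ' → Der c h T' Γ' Δ'
Der-mono {T = T} {Γ} {Δ} d T⊆ Γ⊆ Δ⊆ =
  Der-subst-⊆ idS id d (⊆-trans (⊆-reflexive ([]T-identity T)) T⊆)
    (⊆-trans (⊆-reflexive ([]C-identity Γ)) Γ⊆) (⊆-trans (⊆-reflexive ([]C-identity Δ)) Δ⊆)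

weakenʳ : ∀ {c h T Γ Δ α n φ} → α ∈ T → Der c h T Γ Δ → Der c h T Γ (lf α n φ ∷ Δ)
weakenʳ α∈T d =
  let (tr , gΓ , gΔ) = Der⇒IsTS d in
  Der-mono d ⊆-refl ⊆-refl (xs⊆x∷xs _ _) (tr , gΓ , α∈T ∷ gΔ)

weakenˡ : ∀ {c h T Γ Δ α n φ} → α ∈ T → Der c h T Γ Δ → Der c h T (lf α n φ ∷ Γ) Δ
weakenˡ α∈T d =
  let (tr , gΓ , gΔ) = Der⇒IsTS d in
  Der-mono d ⊆-refl (xs⊆x∷xs _ _) ⊆-refl (tr , α∈T ∷ gΓ , gΔ)

Der-subst : ∀ {c h T Γ Δ} (σ : Subst) → Der c h T Γ Δ → Der c h (T [ σ ]T) (Γ [ σ ]C) (Δ [ σ ]C)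
Der-subst {T = T} {Γ} {Δ} σ d =
  Der-resp-≡ (map-cong ([]L-official σ) T) (map-cong ([]LF-official σ) Γ) (map-cong ([]LF-official σ) Δ)
    (Der-subst-⊆ σ id d ⊆-refl ⊆-refl ⊆-refl (IsTS-subst σ id (Der⇒IsTS d)))

proposition1 : (cut : Bool) →
    ((∀ {h T Γ Δ α n φ} → α ∈ T → Der cut h T Γ Δ →
        Der cut h T Γ (lf α n φ ∷ Δ))
    × (∀ {h T Γ Δ α n φ} → α ∈ T → Der cut h T Γ Δ →
        Der cut h T (lf α n φ ∷ Γ) Δ)
    × (∀ {h T Γ Δ} (σ : Subst) → Der cut h T Γ Δ →
        Der cut h (T [ σ ]T) (Γ [ σ ]C) (Δ [ σ ]C)))
proposition1 cut = weakenʳ , weakenˡ , Der-subst
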